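{- For every nonnegative integer $n$, let $LG_1(n)$ denote the number of partitions of $n$ in which any two consecutive parts differ by at least $2$, and by at least $4$ if both are odd. Let $LG'_{ -1}(n)$ denote the number of signed partitions of $n$ in which the positive parts are distinct and even, and the negative parts are distinct, congruent to $1 \pmod 4$, and each at most $2\ell^+$, where $\ell^+$ is the number of positive parts. Then $LG_1(n)=LG'_{ -1}(n)$ for all $n\ge 0$.
   Context: A partition of an integer $n$ is a finite nonincreasing sequence of positive integers (its parts) summing to $n$. A signed partition of an integer $n$ is a pair $(\pi,\nu)$ of ordinary partitions with $|\pi|-|\nu|=n$, where $|\cdot|$ denotes the sum of parts; the parts of $\pi$ are the positive parts and the parts of $\nu$ are the negative parts (their sizes). $\ell^+$ denotes the number of positive parts of a signed partition. -}

module Defs where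

open import Data.Nat using (ℕ; _+_; _*_; _≤_; _<_; _%_)
open import Data.Nat.Base using (_≡ᵇ_)
open import Data.Bool using (Bool; if_then_else_; _∧_)
open import Data.List using (List; length)
open import Data.Nat.ListAction using (sum)
open import Data.List.Relation.Unary.All using (All)
open import Data.List.Relation.Unary.Linked using (Linked)
open import Data.Product using (Σ; _×_; _,_)
open import Relation.Binary.PropositionalEquality using (_≡_)

record IsPartition (n : ℕ) (xs : List ℕ) : Set where
  field
    positive    : All (λ x → 1 ≤ x) xs
    nonincr     : Linked (λ a b → b ≤ a) xs
    sumIs       : sum xs ≡ n

isOdd : ℕ → Bool
isOdd x = x % 2 ≡ᵇ 1

gap : ℕ → ℕ → ℕ
gap a b = if isOdd a ∧ isOdd b then 4 else 2

GapOK : ℕ → ℕ → Set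
GapOK a b = b + gap a b ≤ a

LG1 : ℕ → Set
LG1 n = Σ (List ℕ) λ xs → IsPartition n xs × Linked GapOK xs

-- A signed partition (π , ν) of n : π, ν ordinary partitions with |π| - |ν| = n,
-- with positive parts distinct and even, negative parts distinct,
-- ≡ 1 (mod 4) and each ≤ 2 ℓ⁺ where ℓ⁺ = length π.
record IsLG'Signed (n : ℕ) (π ν : List ℕ) : Set where
  field
    πPart     : IsPartition (sum π) π
    νPart     : IsPartition (sum ν) ν
    signedSum : sum π ≡ n + sum ν
    πDistinct : Linked (λ a b → b < a) π
    πEven     : All (λ x → x % 2 ≡ 0) π
    νDistinct : Linked (λ a b → b < a) ν
    νMod4     : All (λ x → x % 4 ≡ 1) ν
    νBound    : All (λ x → x ≤ 2 * length π) ν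

LG'₋₁ : ℕ → Set
LG'₋₁ n = Σ (List ℕ × List ℕ) λ { (π , ν) → IsLG'Signed n π ν }

-- Both families are enumerated by level: level k holds the objects whose positive parts are
-- at most 2k − 2.  A gap partition of level k + 2 either has level k + 1, or is 2k + 2 placed
-- on top of one of level k + 1, or is 2k + 1 placed on top of one of level k.  Signed
-- partitions obey the same recursion: either add the positive part 2k + 2 (push), or add
-- 2 to every positive part, pad with a part 2 to an even number ℓ of positive parts, put
-- 2k + 2 on top and add the negative part 2ℓ + 1 (pushRaised).  Both steps change the
-- weight exactly as their counterparts on the gap side, so the two listings of level n + 2,
-- which contain every object of weight n, agree elementwise in weight.  Each listing is
-- duplicate-free and exhaustive, so the elements of weight n are counted by the same number.
module Submission where

open import Defs
open import Axiom.UniquenessOfIdentityProofs using (module Decidable⇒UIP)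
open import Data.Bool using (Bool; true; false; not; if_then_else_; _∧_)
open import Data.Empty using (⊥)
open import Data.Fin using (Fin; zero; suc)
open import Data.List using (List; []; _∷_; _++_; map; length; lookup; filter)
open import Data.List.Membership.Propositional using (_∈_)
open import Data.List.Membership.Propositional.Properties
  using (∈-++⁺ˡ; ∈-++⁺ʳ; ∈-++⁻; ∈-map⁺; ∈-map⁻; ∈-lookup; ∈-filter⁺; ∈-filter⁻)
open import Data.List.Membership.Setoid.Properties using (unique⇒irrelevant)
open import Data.List.Properties using (∷-injectiveˡ; ∷-injectiveʳ; ≡-dec)
open import Data.List.Relation.Binary.Disjoint.Propositional using (Disjoint)
open import Data.List.Relation.Binary.Pointwise as Pointwise using (Pointwise; []; _∷_)
open import Data.List.Relation.Unary.All as All using (All; []; _∷_; tabulate)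
open import Data.List.Relation.Unary.AllPairs using ([]; _∷_)
open import Data.List.Relation.Unary.Any as Any using (here; there)
open import Data.List.Relation.Unary.Any.Properties using (lookup-index)
open import Data.List.Relation.Unary.Linked as Linked using (Linked; []; [-]; _∷_)
open import Data.List.Relation.Unary.Linked.Properties using (Linked⇒All)
open import Data.List.Relation.Unary.Unique.Propositional using (Unique)
import Data.List.Relation.Unary.Unique.Propositional.Properties as Unique
open import Data.Nat using (ℕ; zero; suc; _+_; _*_; _%_; _≤_; _<_; _>_; z≤n; s≤s; s≤s⁻¹; _≟_; _≤?_)
open import Data.Nat.ListAction using (sum)
open import Data.Nat.Properties
open import Data.Nat.Tactic.RingSolver using (solve-∀)
open import Data.Product using (Σ; ∃-syntax; _×_; _,_; uncurry)
open import Data.Product.Properties using (Σ-≡,≡→≡; ,-injectiveˡ; ,-injectiveʳ) renaming (≡-dec to _×-≟_)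
open import Data.Sum using (_⊎_; inj₁; inj₂)
open import Data.Unit using (⊤)
open import Function using (_∘_)
open import Function.Bundles using (_↔_; mk↔ₛ′)
open import Relation.Binary.Definitions using (DecidableEquality)
open import Relation.Binary.PropositionalEquality
open import Relation.Nullary using (Dec; yes; no)
open import Relation.Unary using (Irrelevant)

module _ {A : Set} where

  Linked-cons : ∀ {R : A → A → Set} {x xs} → All (R x) xs → Linked R xs → Linked R (x ∷ xs)
  Linked-cons [] _ = [-]
  Linked-cons (Rxy ∷ _) linked = Rxy ∷ linked

  Linked⇒All-tail : ∀ {R : A → A → Set} → (∀ {a b c} → R a b → R b c → R a c) →
                    ∀ {x xs} → Linked R (x ∷ xs) → All (R x) xs
  Linked⇒All-tail trans [-] = []
  Linked⇒All-tail trans (Rxy ∷ linked) = Linked⇒All trans Rxy linked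

  Linked-strengthen : ∀ {P : A → Set} {R S : A → A → Set} → (∀ {a b} → P a → P b → R a b → S a b) →
                      ∀ {xs} → All P xs → Linked R xs → Linked S xs
  Linked-strengthen f [] [] = []
  Linked-strengthen f (_ ∷ []) [-] = [-]
  Linked-strengthen f (pa ∷ pb ∷ ps) (r ∷ rs) = f pa pb r ∷ Linked-strengthen f (pb ∷ ps) rs

  index-∈-lookup : (xs : List A) (i : Fin (length xs)) → Any.index (∈-lookup {xs = xs} i) ≡ i
  index-∈-lookup (x ∷ xs) zero = refl
  index-∈-lookup (x ∷ xs) (suc i) = cong suc (index-∈-lookup xs i)

  Fin-length↔Σ : DecidableEquality A → (xs : List A) → Unique xs →
                 {P : A → Set} → Irrelevant P → (∀ {x} → P x → x ∈ xs) → (∀ {x} → x ∈ xs → P x) →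
                 Fin (length xs) ↔ Σ A P
  Fin-length↔Σ _≟_ xs unique {P} P-irrelevant complete sound = mk↔ₛ′ to from to∘from from∘to
    where
    to : Fin (length xs) → Σ A P
    to i = lookup xs i , sound (∈-lookup i)
    from : Σ A P → Fin (length xs)
    from (_ , px) = Any.index (complete px)
    to∘from : ∀ p → to (from p) ≡ p
    to∘from (x , px) = Σ-≡,≡→≡ (sym (lookup-index (complete px)) , P-irrelevant _ _)
    ∈-irrelevant : ∀ {x} (p q : x ∈ xs) → p ≡ q
    ∈-irrelevant = unique⇒irrelevant (setoid A) (Decidable⇒UIP.≡-irrelevant _≟_) unique
    from∘to : ∀ i → from (to i) ≡ i
    from∘to i = trans (cong Any.index (∈-irrelevant _ _)) (index-∈-lookup xs i)

  Unique-map⁺-on : ∀ {B : Set} {P : A → Set} {f : A → B} →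
                   (∀ {x y} → P x → P y → f x ≡ f y → x ≡ y) →
                   ∀ {xs} → All P xs → Unique xs → Unique (map f xs)
  Unique-map⁺-on inj [] [] = []
  Unique-map⁺-on {P = P} {f} inj (px ∷ pxs) (x∉xs ∷ u) = distinct px pxs x∉xs ∷ Unique-map⁺-on inj pxs u
    where
    distinct : ∀ {x ys} → P x → All P ys → All (x ≢_) ys → All (f x ≢_) (map f ys)
    distinct px [] [] = []
    distinct px (py ∷ pys) (x≢y ∷ x≢ys) = (λ e → x≢y (inj px py e)) ∷ distinct px pys x≢ys

∈⇒≤sum : ∀ {x xs} → x ∈ xs → x ≤ sum xs
∈⇒≤sum {xs = y ∷ ys} (here refl) = m≤m+n y (sum ys)
∈⇒≤sum {xs = y ∷ ys} (there x∈) = m≤n⇒m≤o+n y (∈⇒≤sum x∈)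

module RecursiveListing {A : Set} (ε : A) (new₁ new₂ : ℕ → A → A) where

  listing : ℕ → List A
  listing zero = ε ∷ []
  listing (suc zero) = ε ∷ []
  listing (suc (suc k)) = listing (suc k) ++ map (new₁ k) (listing (suc k)) ++ map (new₂ k) (listing k)

  Origin : (ℕ → A → Set) → ℕ → A → Set
  Origin V k x = V (suc k) x ⊎ (∃[ y ] V (suc k) y × new₁ k y ≡ x) ⊎ (∃[ y ] V k y × new₂ k y ≡ x)

  record Splitting (V : ℕ → A → Set) : Set where
    field
      ε-valid        : ∀ k → V k ε
      only-ε₀        : ∀ {x} → V 0 x → x ≡ ε
      only-ε₁        : ∀ {x} → V 1 x → x ≡ ε
      weaken         : ∀ k {x} → V (suc k) x → V (suc (suc k)) x
      new₁-valid     : ∀ k {x} → V (suc k) x → V (suc (suc k)) (new₁ k x)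
      new₂-valid     : ∀ k {x} → V k x → V (suc (suc k)) (new₂ k x)
      split          : ∀ k {x} → V (suc (suc k)) x → Origin V k x
      new₁-injective : ∀ k {x y} → V (suc k) x → V (suc k) y → new₁ k x ≡ new₁ k y → x ≡ y
      new₂-injective : ∀ k {x y} → V k x → V k y → new₂ k x ≡ new₂ k y → x ≡ y
      old≢new₁       : ∀ k {x y} → V (suc k) x → V (suc k) y → x ≢ new₁ k y
      old≢new₂       : ∀ k {x y} → V (suc k) x → V k y → x ≢ new₂ k y
      new₁≢new₂      : ∀ k {x y} → V (suc k) x → V k y → new₁ k x ≢ new₂ k y

  module _ {V : ℕ → A → Set} (S : Splitting V) where
    open Splitting S

    listing-sound-step : ∀ k → (∀ {x} → x ∈ listing (suc k) → V (suc k) x) →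
                         (∀ {x} → x ∈ listing k → V k x) →
                         ∀ {x} → x ∈ listing (suc (suc k)) → V (suc (suc k)) x
    listing-sound-step k sound₁ sound₀ x∈ with ∈-++⁻ (listing (suc k)) x∈
    ... | inj₁ x∈old = weaken k (sound₁ x∈old)
    ... | inj₂ x∈new with ∈-++⁻ (map (new₁ k) (listing (suc k))) x∈new
    ...   | inj₁ x∈new₁ with ∈-map⁻ (new₁ k) x∈new₁
    ...     | _ , y∈ , refl = new₁-valid k (sound₁ y∈)
    listing-sound-step k sound₁ sound₀ x∈ | inj₂ x∈new | inj₂ x∈new₂ with ∈-map⁻ (new₂ k) x∈new₂
    ...     | _ , y∈ , refl = new₂-valid k (sound₀ y∈)

    listing-sound : ∀ k {x} → x ∈ listing k → V k x
    listing-sound zero (here refl) = ε-valid 0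
    listing-sound (suc zero) (here refl) = ε-valid 1
    listing-sound (suc (suc k)) = listing-sound-step k (listing-sound (suc k)) (listing-sound k)

    listing-complete-step : ∀ k → (∀ {x} → V (suc k) x → x ∈ listing (suc k)) →
                            (∀ {x} → V k x → x ∈ listing k) →
                            ∀ {x} → V (suc (suc k)) x → x ∈ listing (suc (suc k))
    listing-complete-step k complete₁ complete₀ v with split k v
    ... | inj₁ v′ = ∈-++⁺ˡ (complete₁ v′)
    ... | inj₂ (inj₁ (y , v′ , refl)) =
      ∈-++⁺ʳ (listing (suc k)) (∈-++⁺ˡ (∈-map⁺ (new₁ k) (complete₁ v′)))
    ... | inj₂ (inj₂ (y , v′ , refl)) =
      ∈-++⁺ʳ (listing (suc k))
        (∈-++⁺ʳ (map (new₁ k) (listing (suc k))) (∈-map⁺ (new₂ k) (complete₀ v′)))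

    listing-complete : ∀ k {x} → V k x → x ∈ listing k
    listing-complete zero v with only-ε₀ v
    ... | refl = here refl
    listing-complete (suc zero) v with only-ε₁ v
    ... | refl = here refl
    listing-complete (suc (suc k)) = listing-complete-step k (listing-complete (suc k)) (listing-complete k)

    listing-unique : ∀ k → Unique (listing k)
    listing-unique zero = [] ∷ []
    listing-unique (suc zero) = [] ∷ []
    listing-unique (suc (suc k)) =
      Unique.++⁺ (listing-unique (suc k))
        (Unique.++⁺
          (Unique-map⁺-on (new₁-injective k) (tabulate (listing-sound (suc k))) (listing-unique (suc k)))
          (Unique-map⁺-on (new₂-injective k) (tabulate (listing-sound k)) (listing-unique k))
          new₁-disjoint-new₂)
        old-disjoint-new
      where
      new₁-disjoint-new₂ : Disjoint (map (new₁ k) (listing (suc k))) (map (new₂ k) (listing k))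
      new₁-disjoint-new₂ (z∈new₁ , z∈new₂) with ∈-map⁻ (new₁ k) z∈new₁ | ∈-map⁻ (new₂ k) z∈new₂
      ... | x , x∈ , refl | y , y∈ , eq = new₁≢new₂ k (listing-sound (suc k) x∈) (listing-sound k y∈) eq
      old-disjoint-new : Disjoint (listing (suc k)) (map (new₁ k) (listing (suc k)) ++ map (new₂ k) (listing k))
      old-disjoint-new (z∈old , z∈new) with ∈-++⁻ (map (new₁ k) (listing (suc k))) z∈new
      ... | inj₁ z∈new₁ with ∈-map⁻ (new₁ k) z∈new₁
      ...   | y , y∈ , refl = old≢new₁ k (listing-sound (suc k) z∈old) (listing-sound (suc k) y∈) refl
      old-disjoint-new (z∈old , z∈new) | inj₂ z∈new₂ with ∈-map⁻ (new₂ k) z∈new₂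
      ...   | y , y∈ , refl = old≢new₂ k (listing-sound (suc k) z∈old) (listing-sound k y∈) refl

module _ {A B : Set} {R : A → B → Set} {εA : A} {εB : B} {f₁ f₂ : ℕ → A → A} {g₁ g₂ : ℕ → B → B}
         (R-ε : R εA εB) (R-new₁ : ∀ k {x y} → R x y → R (f₁ k x) (g₁ k y))
         (R-new₂ : ∀ k {x y} → R x y → R (f₂ k x) (g₂ k y)) where
  open RecursiveListing using (listing)

  listing-pointwise : ∀ k → Pointwise R (listing εA f₁ f₂ k) (listing εB g₁ g₂ k)
  listing-pointwise zero = R-ε ∷ []
  listing-pointwise (suc zero) = R-ε ∷ []
  listing-pointwise (suc (suc k)) =
    Pointwise.++⁺ (listing-pointwise (suc k))
      (Pointwise.++⁺ (Pointwise.map⁺ (f₁ k) (g₁ k) (Pointwise.map (R-new₁ k) (listing-pointwise (suc k))))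
                     (Pointwise.map⁺ (f₂ k) (g₂ k) (Pointwise.map (R-new₂ k) (listing-pointwise k))))

-- Unlike 2 * suc n, double (suc n) reduces to suc (suc (double n)), so matching on a proof
-- of x ≡ double (suc i) exposes the shape of x.
double : ℕ → ℕ
double zero = zero
double (suc n) = suc (suc (double n))

double≡2* : ∀ n → double n ≡ 2 * n
double≡2* zero = refl
double≡2* (suc n) = cong suc (trans (cong suc (double≡2* n)) (sym (+-suc n (n + 0))))

n≤double[n] : ∀ n → n ≤ double n
n≤double[n] zero = z≤n
n≤double[n] (suc n) = s≤s (m≤n⇒m≤1+n (n≤double[n] n))

double-mono-≤ : ∀ {m n} → m ≤ n → double m ≤ double n
double-mono-≤ z≤n = z≤n
double-mono-≤ (s≤s m≤n) = s≤s (s≤s (double-mono-≤ m≤n))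

double-cancel-≤ : ∀ {m n} → double m ≤ double n → m ≤ n
double-cancel-≤ {zero} _ = z≤n
double-cancel-≤ {suc m} {suc n} (s≤s (s≤s le)) = s≤s (double-cancel-≤ le)

double-cancel-< : ∀ {m n} → double m < double n → m < n
double-cancel-< {zero} {suc n} _ = s≤s z≤n
double-cancel-< {suc m} {suc n} (s≤s (s≤s lt)) = s≤s (double-cancel-< lt)

double-cancel-≤-suc : ∀ {m n} → double m ≤ suc (double n) → m ≤ n
double-cancel-≤-suc {zero} _ = z≤n
double-cancel-≤-suc {suc m} {suc n} (s≤s (s≤s le)) = s≤s (double-cancel-≤-suc le)

double-squeeze : ∀ {l m} → double l < suc (double m) → suc (double m) ≤ double (suc l) → l ≡ m
double-squeeze above below = ≤-antisym (double-cancel-≤ (s≤s⁻¹ above)) (double-cancel-≤-suc (s≤s⁻¹ below))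

_>[_]_ : ℕ → ℕ → ℕ → Set
a >[ d ] b = d + b ≤ a

>[]-trans : ∀ {d a b c} → a >[ d ] b → b >[ d ] c → a >[ d ] c
>[]-trans {d} a>b b>c = ≤-trans b>c (≤-trans (m≤n+m _ d) a>b)

>-trans : ∀ {a b c} → a > b → b > c → a > c
>-trans a>b b>c = <-trans b>c a>b

-- Parts at most 2k − 2: this offset makes levels 0 and 1 both consist of the empty list alone.
Bounded : ℕ → List ℕ → Set
Bounded k = All (double k >[ 2 ]_)

Bounded-suc : ∀ {k xs} → Bounded k xs → Bounded (suc k) xs
Bounded-suc = All.map (λ le → ≤-trans le (m≤n+m _ 2))

Bounded-head-≢ : ∀ {k xs x ys} → Bounded (suc k) xs → suc (double k) ≤ x → xs ≢ x ∷ ys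
Bounded-head-≢ (x-bound ∷ _) le refl = 1+n≰n (≤-trans le (s≤s⁻¹ (s≤s⁻¹ x-bound)))

≤2+⇒Bounded : ∀ {n x} → x ≤ 2 + n → double (2 + n) >[ 2 ] x
≤2+⇒Bounded {n} x≤ = s≤s (s≤s (≤-trans x≤ (s≤s (s≤s (n≤double[n] n)))))

gap-double : ∀ k y → gap (double k) y ≡ 2
gap-double zero y = refl
gap-double (suc k) y = gap-double k y

gap-odd : ∀ k y → gap (suc (double k)) y ≡ gap 1 y
gap-odd zero y = refl
gap-odd (suc k) y = gap-odd k y

gap≥2 : ∀ a b → 2 ≤ gap a b
gap≥2 a b with isOdd a ∧ isOdd b
... | true = s≤s (s≤s z≤n)
... | false = ≤-refl

GapOK⇒>[2] : ∀ {a b} → GapOK a b → a >[ 2 ] b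
GapOK⇒>[2] {a} {b} ok = subst (_≤ a) (+-comm b 2) (≤-trans (+-monoʳ-≤ b (gap≥2 a b)) ok)

>[2]⇒GapOK-double : ∀ k {y} → double k >[ 2 ] y → GapOK (double k) y
>[2]⇒GapOK-double k {y} lt rewrite gap-double k y | +-comm y 2 = lt

GapOK-odd⇒ : ∀ k y → GapOK (suc (double k)) y → double k >[ 2 ] y
GapOK-odd⇒ zero y ok with GapOK⇒>[2] {1} {y} ok
... | s≤s ()
GapOK-odd⇒ (suc k) zero _ = s≤s (s≤s z≤n)
GapOK-odd⇒ (suc k) (suc zero) ok rewrite gap-odd (suc k) 1 = m≤n⇒m≤1+n (s≤s⁻¹ (s≤s⁻¹ ok))
GapOK-odd⇒ (suc k) (suc (suc y)) (s≤s (s≤s ok)) = s≤s (s≤s (GapOK-odd⇒ k y ok))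

GapOK-odd⇐ : ∀ k y → double k >[ 2 ] y → GapOK (suc (double k)) y
GapOK-odd⇐ (suc k) zero _ rewrite gap-odd (suc k) 0 = s≤s (s≤s z≤n)
GapOK-odd⇐ (suc zero) (suc zero) (s≤s (s≤s ()))
GapOK-odd⇐ (suc (suc k)) (suc zero) _ rewrite gap-odd (suc (suc k)) 1 = s≤s (s≤s (s≤s (s≤s (s≤s z≤n))))
GapOK-odd⇐ (suc k) (suc (suc y)) (s≤s (s≤s lt)) = s≤s (s≤s (GapOK-odd⇐ k y lt))

record GapPartitionBelow (k : ℕ) (xs : List ℕ) : Set where
  field
    positive : All (1 ≤_) xs
    gaps     : Linked GapOK xs
    bounded  : Bounded k xs

GapPartitionBelow-tail : ∀ {k m x xs} → GapPartitionBelow k (x ∷ xs) → (∀ {y} → GapOK x y → double m >[ 2 ] y) →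
                         GapPartitionBelow m xs
GapPartitionBelow-tail {m = m} {x} v bound = record
  { positive = All.tail positive ; gaps = Linked.tail gaps ; bounded = tail-bounded gaps }
  where
  open GapPartitionBelow v
  tail-bounded : ∀ {xs} → Linked GapOK (x ∷ xs) → Bounded m xs
  tail-bounded [-] = []
  tail-bounded (ok ∷ gaps′) = Linked⇒All >[]-trans (bound ok) (Linked.map GapOK⇒>[2] gaps′)

GapPartitionBelow-suc : ∀ {k xs} → GapPartitionBelow k xs → GapPartitionBelow (suc k) xs
GapPartitionBelow-suc v = record { positive = positive ; gaps = gaps ; bounded = Bounded-suc bounded }
  where open GapPartitionBelow v

module GapListing = RecursiveListing {List ℕ} [] (λ k → double (suc k) ∷_) (λ k → suc (double k) ∷_)

gap-split : ∀ k {xs} → GapPartitionBelow (suc (suc k)) xs → GapListing.Origin GapPartitionBelow k xs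
gap-split k {[]} _ = inj₁ record { positive = [] ; gaps = [] ; bounded = [] }
gap-split k {x ∷ xs} v with x ≟ double (suc k) | x ≟ suc (double k)
... | yes refl | _ = inj₂ (inj₁ (xs , GapPartitionBelow-tail v GapOK⇒>[2] , refl))
... | no _ | yes refl = inj₂ (inj₂ (xs , GapPartitionBelow-tail v (GapOK-odd⇒ k _) , refl))
... | no x≢2k+2 | no x≢2k+1 = inj₁ record
  { positive = positive ; gaps = gaps ; bounded = Linked⇒All >[]-trans x-bound (Linked.map GapOK⇒>[2] gaps) }
  where
  open GapPartitionBelow v
  ≤pred : ∀ {y n} → y ≤ suc n → y ≢ suc n → y ≤ n
  ≤pred le ne = <⇒≤pred (≤∧≢⇒< le ne)
  x-bound : double (suc k) >[ 2 ] x
  x-bound = s≤s (s≤s (≤pred (≤pred (s≤s⁻¹ (s≤s⁻¹ (All.head bounded))) x≢2k+2) x≢2k+1))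

gap-splitting : GapListing.Splitting GapPartitionBelow
gap-splitting = record
  { ε-valid = λ _ → record { positive = [] ; gaps = [] ; bounded = [] }
  ; only-ε₀ = level₀
  ; only-ε₁ = level₁
  ; weaken = λ _ → GapPartitionBelow-suc
  ; new₁-valid = new₁-valid
  ; new₂-valid = new₂-valid
  ; split = gap-split
  ; new₁-injective = λ _ _ _ → ∷-injectiveʳ
  ; new₂-injective = λ _ _ _ → ∷-injectiveʳ
  ; old≢new₁ = λ _ v _ → Bounded-head-≢ (bounded v) (n≤1+n _)
  ; old≢new₂ = λ _ v _ → Bounded-head-≢ (bounded v) ≤-refl
  ; new₁≢new₂ = λ _ _ _ eq → 1+n≢n (∷-injectiveˡ eq)
  }
  where
  open GapPartitionBelow
  level₀ : ∀ {xs} → GapPartitionBelow 0 xs → xs ≡ []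
  level₀ {[]} _ = refl
  level₀ {x ∷ _} record { bounded = () ∷ _ }
  level₁ : ∀ {xs} → GapPartitionBelow 1 xs → xs ≡ []
  level₁ {[]} _ = refl
  level₁ {zero ∷ _} record { positive = () ∷ _ }
  level₁ {suc x ∷ _} record { bounded = s≤s (s≤s ()) ∷ _ }
  new₁-valid : ∀ k {xs} → GapPartitionBelow (suc k) xs → GapPartitionBelow (suc (suc k)) (double (suc k) ∷ xs)
  new₁-valid k v = record
    { positive = s≤s z≤n ∷ positive v
    ; gaps = Linked-cons (All.map (>[2]⇒GapOK-double (suc k)) (bounded v)) (gaps v)
    ; bounded = ≤-refl ∷ Bounded-suc (bounded v)
    }
  new₂-valid : ∀ k {xs} → GapPartitionBelow k xs → GapPartitionBelow (suc (suc k)) (suc (double k) ∷ xs)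
  new₂-valid k v = record
    { positive = s≤s z≤n ∷ positive v
    ; gaps = Linked-cons (All.map (GapOK-odd⇐ k _) (bounded v)) (gaps v)
    ; bounded = n≤1+n _ ∷ Bounded-suc (Bounded-suc (bounded v))
    }

PositiveEven : ℕ → Set
PositiveEven x = ∃[ i ] x ≡ double (suc i)

OneMod4 : ℕ → Set
OneMod4 y = ∃[ j ] y ≡ suc (double (double j))

PositiveEven-> : ∀ {a b} → PositiveEven a → PositiveEven b → a > b → a >[ 2 ] b
PositiveEven-> (i , refl) (j , refl) a>b = double-mono-≤ (double-cancel-< a>b)

PositiveEven-separated : ∀ {π} → All PositiveEven π → Linked _>_ π → Linked (_>[ 2 ]_) π
PositiveEven-separated = Linked-strengthen PositiveEven->

OneMod4-> : ∀ {a b} → OneMod4 a → OneMod4 b → a > b → a >[ 4 ] b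
OneMod4-> (i , refl) (j , refl) a>b =
  s≤s (double-mono-≤ (double-mono-≤ (double-cancel-< (double-cancel-< (s≤s⁻¹ a>b)))))

record EvenPartsBelow (k : ℕ) (π : List ℕ) : Set where
  field
    even       : All PositiveEven π
    decreasing : Linked _>_ π
    bounded    : Bounded k π

  separated : Linked (_>[ 2 ]_) π
  separated = PositiveEven-separated even decreasing

EvenPartsBelow-suc : ∀ {k π} → EvenPartsBelow k π → EvenPartsBelow (suc k) π
EvenPartsBelow-suc e = record { even = even ; decreasing = decreasing ; bounded = Bounded-suc bounded }
  where open EvenPartsBelow e

EvenPartsBelow-cons : ∀ {k π} → EvenPartsBelow (suc k) π → EvenPartsBelow (suc (suc k)) (double (suc k) ∷ π)
EvenPartsBelow-cons e = record
  { even = (_ , refl) ∷ even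
  ; decreasing = Linked-cons (All.map (≤-trans (n≤1+n _)) bounded) decreasing
  ; bounded = ≤-refl ∷ Bounded-suc bounded
  }
  where open EvenPartsBelow e

EvenPartsBelow-rebound : ∀ {k m x π} → EvenPartsBelow k (x ∷ π) → double m >[ 2 ] x → EvenPartsBelow m (x ∷ π)
EvenPartsBelow-rebound e x-bound = record
  { even = even ; decreasing = decreasing ; bounded = Linked⇒All >[]-trans x-bound separated }
  where open EvenPartsBelow e

EvenPartsBelow-uncons : ∀ {k m π} → EvenPartsBelow k (double (suc m) ∷ π) → EvenPartsBelow (suc m) π
EvenPartsBelow-uncons e = record
  { even = All.tail even ; decreasing = Linked.tail decreasing ; bounded = Linked⇒All-tail >[]-trans separated }
  where open EvenPartsBelow e

-- Parity p n holds when n is odd exactly if p is true.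
Parity : Bool → ℕ → Set
Parity p zero = if p then ⊥ else ⊤
Parity p (suc n) = Parity (not p) n

Parity-double : ∀ h → Parity false (double h)
Parity-double zero = _
Parity-double (suc h) = Parity-double h

Parity-false⇒double : ∀ n → Parity false n → ∃[ h ] n ≡ double h
Parity-false⇒double zero _ = zero , refl
Parity-false⇒double (suc (suc n)) p with Parity-false⇒double n p
... | h , refl = suc h , refl

-- raise p π adds 2 to every part of π and appends a part 2 when the flag p, flipped once per
-- part, ends up true; so raise false π has even length.
raise : Bool → List ℕ → List ℕ
raise p [] = if p then 2 ∷ [] else []
raise p (x ∷ π) = 2 + x ∷ raise (not p) π

raise-parity : ∀ p π → Parity p (length (raise p π))
raise-parity false [] = _
raise-parity true [] = _
raise-parity p (x ∷ π) = raise-parity (not p) π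

length≤length-raise : ∀ p π → length π ≤ length (raise p π)
length≤length-raise false [] = z≤n
length≤length-raise true [] = z≤n
length≤length-raise p (x ∷ π) = s≤s (length≤length-raise (not p) π)

raise-sum : ∀ p π → sum (raise p π) ≡ sum π + double (length (raise p π))
raise-sum false [] = refl
raise-sum true [] = refl
raise-sum p (x ∷ π) = begin
  2 + x + sum (raise (not p) π)  ≡⟨ cong (2 + x +_) (raise-sum (not p) π) ⟩
  2 + x + (sum π + double l)     ≡⟨ shuffle x (sum π) (double l) ⟩
  x + sum π + (2 + double l)     ∎
  where
  open ≡-Reasoning
  l = length (raise (not p) π)
  shuffle : ∀ a s d → 2 + a + (s + d) ≡ a + s + (2 + d)
  shuffle = solve-∀

raise-OneMod4 : ∀ π → OneMod4 (suc (double (length (raise false π))))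
raise-OneMod4 π with Parity-false⇒double _ (raise-parity false π)
... | h , length≡ = h , cong (suc ∘ double) length≡

raise-injective : ∀ p {π₁ π₂} → All PositiveEven π₁ → All PositiveEven π₂ →
                  raise p π₁ ≡ raise p π₂ → π₁ ≡ π₂
raise-injective false [] [] _ = refl
raise-injective true [] [] _ = refl
raise-injective true [] ((_ , refl) ∷ []) ()
raise-injective true ((_ , refl) ∷ []) [] ()
raise-injective p (_ ∷ e₁) (_ ∷ e₂) eq =
  cong₂ _∷_ (+-cancelˡ-≡ 2 _ _ (∷-injectiveˡ eq)) (raise-injective (not p) e₁ e₂ (∷-injectiveʳ eq))

raise-even : ∀ p {π} → All PositiveEven π → All PositiveEven (raise p π)
raise-even false [] = []
raise-even true [] = (0 , refl) ∷ []
raise-even p ((i , refl) ∷ e) = (suc i , refl) ∷ raise-even (not p) e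

raise-decreasing : ∀ p {π} → All PositiveEven π → Linked _>_ π → Linked _>_ (raise p π)
raise-decreasing false [] [] = []
raise-decreasing true [] [] = [-]
raise-decreasing false ((i , refl) ∷ []) [-] = s≤s (s≤s (s≤s z≤n)) ∷ [-]
raise-decreasing true (_ ∷ []) [-] = [-]
raise-decreasing p (_ ∷ e) (x>y ∷ d) = s≤s (s≤s x>y) ∷ raise-decreasing (not p) e d

raise-bounded : ∀ p {k π} → Bounded (suc k) π → Bounded (suc (suc k)) (raise p π)
raise-bounded false [] = []
raise-bounded true [] = s≤s (s≤s (s≤s (s≤s z≤n))) ∷ []
raise-bounded p (x-bound ∷ b) = s≤s (s≤s x-bound) ∷ raise-bounded (not p) b

raise-EvenPartsBelow : ∀ {k π} → EvenPartsBelow k π → EvenPartsBelow (suc k) (raise false π)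
raise-EvenPartsBelow {zero} {[]} _ = record { even = [] ; decreasing = [] ; bounded = [] }
raise-EvenPartsBelow {zero} {x ∷ π} e with EvenPartsBelow.bounded e
... | () ∷ _
raise-EvenPartsBelow {suc k} e = record
  { even = raise-even false even
  ; decreasing = raise-decreasing false even decreasing
  ; bounded = raise-bounded false bounded
  }
  where open EvenPartsBelow e

cons-raise-decreasing : ∀ p {a y r} ρ → raise p ρ ≡ y ∷ r → 2 + a > y → Linked _>_ ρ → Linked _>_ (a ∷ ρ)
cons-raise-decreasing p [] _ _ _ = [-]
cons-raise-decreasing p (z ∷ ρ) refl a>y d = s≤s⁻¹ (s≤s⁻¹ a>y) ∷ d

unraise : ∀ p {k π′} → EvenPartsBelow (suc k) π′ → Parity p (length π′) →
          ∃[ π ] raise p π ≡ π′ × EvenPartsBelow k π × length π′ ≤ suc (length π)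
unraise false {π′ = []} _ _ = [] , refl , record { even = [] ; decreasing = [] ; bounded = [] } , z≤n
unraise true {π′ = x ∷ []} record { even = (zero , refl) ∷ [] } _ =
  [] , refl , record { even = [] ; decreasing = [] ; bounded = [] } , ≤-refl
unraise true {π′ = x ∷ []} record { even = (suc i , refl) ∷ [] ; bounded = x-bound ∷ [] } _ =
  double (suc i) ∷ [] , refl ,
  record { even = (i , refl) ∷ [] ; decreasing = [-] ; bounded = s≤s⁻¹ (s≤s⁻¹ x-bound) ∷ [] } , s≤s z≤n
unraise p {π′ = x ∷ y ∷ π′} record { even = (zero , refl) ∷ (_ , refl) ∷ _ ; decreasing = s≤s (s≤s ()) ∷ _ } _
unraise p {π′ = x ∷ y ∷ π′} record { even = (suc i , refl) ∷ e ; decreasing = x>y ∷ d ; bounded = x-bound ∷ b } par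
  with unraise (not p) record { even = e ; decreasing = d ; bounded = b } par
... | ρ , eq , e′ , len = double (suc i) ∷ ρ , cong (_ ∷_) eq , record
  { even = (i , refl) ∷ EvenPartsBelow.even e′
  ; decreasing = cons-raise-decreasing (not p) ρ eq x>y (EvenPartsBelow.decreasing e′)
  ; bounded = s≤s⁻¹ (s≤s⁻¹ x-bound) ∷ EvenPartsBelow.bounded e′
  } , s≤s len

record SignedPartitionBelow (k : ℕ) (π ν : List ℕ) : Set where
  field
    positives    : EvenPartsBelow k π
    oneMod4      : All OneMod4 ν
    ν-decreasing : Linked _>_ ν
    ν-bounded    : All (_≤ double (length π)) ν

SignedBelow : ℕ → List ℕ × List ℕ → Set
SignedBelow k = uncurry (SignedPartitionBelow k)

push : ℕ → List ℕ × List ℕ → List ℕ × List ℕ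
push k (π , ν) = double (suc k) ∷ π , ν

pushRaised : ℕ → List ℕ × List ℕ → List ℕ × List ℕ
pushRaised k (π , ν) = double (suc k) ∷ raise false π , suc (double (length (raise false π))) ∷ ν

module SignedListing = RecursiveListing ([] , []) push pushRaised

-- 2ℓ < y ≤ 2ℓ + 2 with y ≡ 1 (mod 4) forces y = 2ℓ + 1 with ℓ = length π′ even, so π′ can be unraised.
signed-split-raised : ∀ k {π′ y ν′} → EvenPartsBelow (suc k) π′ →
                      OneMod4 y → All OneMod4 ν′ → Linked _>_ (y ∷ ν′) →
                      y ≤ double (suc (length π′)) → double (length π′) < y →
                      ∃[ p ] SignedBelow k p × pushRaised k p ≡ (double (suc k) ∷ π′ , y ∷ ν′)
signed-split-raised k {π′} {ν′ = ν′} e (j , refl) q d y-bound y-above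
  with unraise false e (subst (Parity false) (sym (double-squeeze y-above y-bound)) (Parity-double j))
... | π , raise≡ , e′ , len =
  (π , ν′) , valid , cong₂ _,_ (cong (_ ∷_) raise≡) (cong (λ l → suc (double l) ∷ ν′) length≡)
  where
  length≡ : length (raise false π) ≡ double j
  length≡ = trans (cong length raise≡) (double-squeeze y-above y-bound)
  double-j≤ : double (double j) ≤ double (suc (length π))
  double-j≤ = double-mono-≤ (subst (_≤ suc (length π)) (double-squeeze y-above y-bound) len)
  ν′-bound : ∀ {z} → suc (double (double j)) >[ 4 ] z → z ≤ double (length π)
  ν′-bound y>z = <⇒≤ (s≤s⁻¹ (s≤s⁻¹ (≤-trans (s≤s⁻¹ y>z) double-j≤)))
  valid : SignedPartitionBelow k π ν′
  valid = record
    { positives = e′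
    ; oneMod4 = q
    ; ν-decreasing = Linked.tail d
    ; ν-bounded = All.map ν′-bound (Linked⇒All-tail >[]-trans (Linked-strengthen OneMod4-> ((j , refl) ∷ q) d))
    }

signed-split-top : ∀ k {π′ ν} → EvenPartsBelow (suc k) π′ → All OneMod4 ν → Linked _>_ ν →
                   All (_≤ double (suc (length π′))) ν →
                   SignedListing.Origin SignedBelow k (double (suc k) ∷ π′ , ν)
signed-split-top k e [] [] [] =
  inj₂ (inj₁ (_ , record { positives = e ; oneMod4 = [] ; ν-decreasing = [] ; ν-bounded = [] } , refl))
signed-split-top k {π′} {y ∷ ν′} e q d b with y ≤? double (length π′)
... | yes y≤ = inj₂ (inj₁ (_ , record
  { positives = e ; oneMod4 = q ; ν-decreasing = d
  ; ν-bounded = y≤ ∷ All.map (λ y>z → ≤-trans (<⇒≤ y>z) y≤) (Linked⇒All-tail >-trans d) } , refl))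
... | no y≰ = inj₂ (inj₂ (signed-split-raised k e (All.head q) (All.tail q) d (All.head b) (≰⇒> y≰)))

PositiveEven-below : ∀ {k x} → PositiveEven x → double (suc (suc k)) >[ 2 ] x → x ≢ double (suc k) →
                     double (suc k) >[ 2 ] x
PositiveEven-below (i , refl) x-bound x≢ = s≤s (s≤s (double-mono-≤ (≤∧≢⇒< i≤k (x≢ ∘ cong (double ∘ suc)))))
  where
  i≤k = s≤s⁻¹ (double-cancel-≤ (s≤s⁻¹ (s≤s⁻¹ x-bound)))

signed-split : ∀ k {p} → SignedBelow (suc (suc k)) p → SignedListing.Origin SignedBelow k p
signed-split k {[] , ν} s = inj₁ record
  { positives = record { even = [] ; decreasing = [] ; bounded = [] }
  ; oneMod4 = oneMod4 ; ν-decreasing = ν-decreasing ; ν-bounded = ν-bounded }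
  where open SignedPartitionBelow s
signed-split k {x ∷ π′ , ν} s with x ≟ double (suc k)
... | yes refl = signed-split-top k (EvenPartsBelow-uncons positives) oneMod4 ν-decreasing ν-bounded
  where open SignedPartitionBelow s
... | no x≢ = inj₁ record
  { positives = EvenPartsBelow-rebound positives (PositiveEven-below (All.head even) (All.head bounded) x≢)
  ; oneMod4 = oneMod4 ; ν-decreasing = ν-decreasing ; ν-bounded = ν-bounded }
  where
  open SignedPartitionBelow s
  open EvenPartsBelow positives

signed-splitting : SignedListing.Splitting SignedBelow
signed-splitting = record
  { ε-valid = λ _ → record
    { positives = record { even = [] ; decreasing = [] ; bounded = [] }
    ; oneMod4 = [] ; ν-decreasing = [] ; ν-bounded = [] }
  ; only-ε₀ = level₀
  ; only-ε₁ = level₁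
  ; weaken = λ _ s → record
    { positives = EvenPartsBelow-suc (positives s) ; oneMod4 = oneMod4 s ; ν-decreasing = ν-decreasing s
    ; ν-bounded = ν-bounded s }
  ; new₁-valid = λ _ s → record
    { positives = EvenPartsBelow-cons (positives s) ; oneMod4 = oneMod4 s ; ν-decreasing = ν-decreasing s
    ; ν-bounded = All.map (λ le → ≤-trans le (double-mono-≤ (n≤1+n _))) (ν-bounded s) }
  ; new₂-valid = new₂-valid
  ; split = signed-split
  ; new₁-injective = λ _ _ _ eq → cong₂ _,_ (∷-injectiveʳ (,-injectiveˡ eq)) (,-injectiveʳ eq)
  ; new₂-injective = λ _ s₁ s₂ eq →
      cong₂ _,_ (raise-injective false (even (positives s₁)) (even (positives s₂)) (∷-injectiveʳ (,-injectiveˡ eq)))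
                (∷-injectiveʳ (,-injectiveʳ eq))
  ; old≢new₁ = λ _ s _ eq → Bounded-head-≢ (bounded (positives s)) (n≤1+n _) (,-injectiveˡ eq)
  ; old≢new₂ = λ _ s _ eq → Bounded-head-≢ (bounded (positives s)) (n≤1+n _) (,-injectiveˡ eq)
  ; new₁≢new₂ = new₁≢new₂
  }
  where
  open SignedPartitionBelow
  open EvenPartsBelow
  level₀ : ∀ {p} → SignedBelow 0 p → p ≡ ([] , [])
  level₀ {[] , []} _ = refl
  level₀ {x ∷ _ , _} record { positives = record { bounded = () ∷ _ } }
  level₀ {[] , y ∷ _} record { oneMod4 = (_ , refl) ∷ _ ; ν-bounded = () ∷ _ }
  level₁ : ∀ {p} → SignedBelow 1 p → p ≡ ([] , [])
  level₁ {[] , []} _ = refl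
  level₁ {x ∷ _ , _} record { positives = record { even = (_ , refl) ∷ _ ; bounded = s≤s (s≤s ()) ∷ _ } }
  level₁ {[] , y ∷ _} record { oneMod4 = (_ , refl) ∷ _ ; ν-bounded = () ∷ _ }
  new₂-valid : ∀ k {p} → SignedBelow k p → SignedBelow (suc (suc k)) (pushRaised k p)
  new₂-valid k {π , ν} s = record
    { positives = EvenPartsBelow-cons (raise-EvenPartsBelow (positives s))
    ; oneMod4 = raise-OneMod4 π ∷ oneMod4 s
    ; ν-decreasing = Linked-cons (All.map (λ le → s≤s (≤-trans le (double-mono-≤ length≤))) (ν-bounded s))
                                 (ν-decreasing s)
    ; ν-bounded = n≤1+n _ ∷ All.map (λ le → ≤-trans le (double-mono-≤ (m≤n⇒m≤1+n length≤))) (ν-bounded s)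
    }
    where
    length≤ = length≤length-raise false π
  new₁≢new₂ : ∀ k {p₁ p₂} → SignedBelow (suc k) p₁ → SignedBelow k p₂ → push k p₁ ≢ pushRaised k p₂
  new₁≢new₂ k s₁ _ eq with ∷-injectiveʳ (,-injectiveˡ eq) | ,-injectiveʳ eq
  ... | refl | refl = 1+n≰n (All.head (ν-bounded s₁))

SameWeight : List ℕ → List ℕ × List ℕ → Set
SameWeight xs (π , ν) = sum xs + sum ν ≡ sum π

push-same-weight : ∀ k {xs p} → SameWeight xs p → SameWeight (double (suc k) ∷ xs) (push k p)
push-same-weight k {xs} {π , ν} w = trans (+-assoc (double (suc k)) (sum xs) (sum ν)) (cong (double (suc k) +_) w)

pushRaised-same-weight : ∀ k {xs p} → SameWeight xs p → SameWeight (suc (double k) ∷ xs) (pushRaised k p)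
pushRaised-same-weight k {xs} {π , ν} w = begin
  suc (double k) + sum xs + (suc (double l) + sum ν)  ≡⟨ shuffle (double k) (sum xs) (double l) (sum ν) ⟩
  double (suc k) + (sum xs + sum ν + double l)        ≡⟨ cong (λ s → double (suc k) + (s + double l)) w ⟩
  double (suc k) + (sum π + double l)                 ≡⟨ cong (double (suc k) +_) (raise-sum false π) ⟨
  double (suc k) + sum (raise false π)                ∎
  where
  open ≡-Reasoning
  l = length (raise false π)
  shuffle : ∀ a s d t → suc a + s + (suc d + t) ≡ 2 + a + (s + t + d)
  shuffle = solve-∀

listings-same-weight : ∀ k → Pointwise SameWeight (GapListing.listing k) (SignedListing.listing k)
listings-same-weight = listing-pointwise refl push-same-weight pushRaised-same-weight

HasWeight : ℕ → List ℕ → Set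
HasWeight n xs = sum xs ≡ n

HasSignedWeight : ℕ → List ℕ × List ℕ → Set
HasSignedWeight n (π , ν) = sum π ≡ n + sum ν

hasWeight? : ∀ n xs → Dec (HasWeight n xs)
hasWeight? n xs = sum xs ≟ n

hasSignedWeight? : ∀ n p → Dec (HasSignedWeight n p)
hasSignedWeight? n (π , ν) = sum π ≟ n + sum ν

-- Level 2 + n suffices: parts of partitions of weight n are at most 2n + 2.
gapsOfWeight : ℕ → List (List ℕ)
gapsOfWeight n = filter (hasWeight? n) (GapListing.listing (2 + n))

signedOfWeight : ℕ → List (List ℕ × List ℕ)
signedOfWeight n = filter (hasSignedWeight? n) (SignedListing.listing (2 + n))

length-gapsOfWeight≡length-signedOfWeight : ∀ n → length (gapsOfWeight n) ≡ length (signedOfWeight n)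
length-gapsOfWeight≡length-signedOfWeight n =
  Pointwise.Pointwise-length (Pointwise.filter⁺ (hasWeight? n) (hasSignedWeight? n)
                                 (λ {xs} {p} → weight⇒ {xs} {p}) (λ {xs} {p} → ⇒weight {xs} {p})
                                 (listings-same-weight (2 + n)))
  where
  weight⇒ : ∀ {xs p} → SameWeight xs p → HasWeight n xs → HasSignedWeight n p
  weight⇒ w refl = sym w
  ⇒weight : ∀ {xs p} → SameWeight xs p → HasSignedWeight n p → HasWeight n xs
  ⇒weight {xs} {π , ν} w eq = +-cancelʳ-≡ (sum ν) (sum xs) n (trans w eq)

IsPartition-irrelevant : ∀ {n xs} (p q : IsPartition n xs) → p ≡ q
IsPartition-irrelevant record { positive = a ; nonincr = b ; sumIs = c }
                       record { positive = a′ ; nonincr = b′ ; sumIs = c′ }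
  rewrite All.irrelevant ≤-irrelevant a a′ | Linked.irrelevant ≤-irrelevant b b′ | ≡-irrelevant c c′ = refl

gap-partition-valid : ∀ {n xs} → IsPartition n xs → Linked GapOK xs → GapPartitionBelow (2 + n) xs
gap-partition-valid {n} p gaps = record
  { positive = positive
  ; gaps = gaps
  ; bounded = tabulate (λ x∈ → ≤2+⇒Bounded (m≤n⇒m≤o+n 2 (subst (_ ≤_) sumIs (∈⇒≤sum x∈))))
  }
  where open IsPartition p

gap-partition-sound : ∀ {k n xs} → GapPartitionBelow k xs → HasWeight n xs → IsPartition n xs × Linked GapOK xs
gap-partition-sound v weight = record
  { positive = positive
  ; nonincr = Linked.map (λ ok → ≤-trans (m≤n+m _ 2) (GapOK⇒>[2] ok)) gaps
  ; sumIs = weight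
  } , gaps
  where open GapPartitionBelow v

LG1-enumeration : ∀ n → Fin (length (gapsOfWeight n)) ↔ LG1 n
LG1-enumeration n =
  Fin-length↔Σ (≡-dec _≟_) (gapsOfWeight n)
    (Unique.filter⁺ (hasWeight? n) (GapListing.listing-unique gap-splitting (2 + n)))
    irrelevant complete sound
  where
  irrelevant : Irrelevant (λ xs → IsPartition n xs × Linked GapOK xs)
  irrelevant (p , l) (p′ , l′) = cong₂ _,_ (IsPartition-irrelevant p p′) (Linked.irrelevant ≤-irrelevant l l′)
  complete : ∀ {xs} → IsPartition n xs × Linked GapOK xs → xs ∈ gapsOfWeight n
  complete (p , gaps) =
    ∈-filter⁺ (hasWeight? n) (GapListing.listing-complete gap-splitting (2 + n) (gap-partition-valid p gaps))
      (IsPartition.sumIs p)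
  sound : ∀ {xs} → xs ∈ gapsOfWeight n → IsPartition n xs × Linked GapOK xs
  sound x∈ with ∈-filter⁻ (hasWeight? n) x∈
  ... | x∈′ , weight = gap-partition-sound (GapListing.listing-sound gap-splitting (2 + n) x∈′) weight

double-length≤head : ∀ {x π} → All PositiveEven (x ∷ π) → Linked _>_ (x ∷ π) → double (length (x ∷ π)) ≤ x
double-length≤head ((i , refl) ∷ []) [-] = s≤s (s≤s z≤n)
double-length≤head (ex ∷ ey ∷ e) (x>y ∷ d) =
  ≤-trans (s≤s (s≤s (double-length≤head (ey ∷ e) d))) (PositiveEven-> ex ey x>y)

-- The largest negative part is at most d plus the largest positive part, and each later
-- negative part is at most the corresponding later positive part.
sum-negative≤ : ∀ {d π ν} → d ≤ 2 → All PositiveEven π → Linked _>_ π → Linked (_>[ 4 ]_) ν →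
                All (_≤ d + double (length π)) ν → sum ν ≤ d + sum π
sum-negative≤ {ν = []} _ _ _ _ _ = z≤n
sum-negative≤ {π = []} {y ∷ []} _ _ _ _ (y-bound ∷ []) = ≤-trans (≤-reflexive (+-identityʳ y)) y-bound
sum-negative≤ {d} {[]} {y ∷ z ∷ _} d≤2 _ _ (y>z ∷ _) (y-bound ∷ _)
  with ≤-trans (≤-trans (m≤m+n 4 z) y>z) (≤-trans y-bound (≤-trans (≤-reflexive (+-identityʳ d)) d≤2))
... | s≤s (s≤s ())
sum-negative≤ {d} {x ∷ π} {y ∷ ν} d≤2 e dec gaps (y-bound ∷ _) = begin
  y + sum ν      ≤⟨ +-mono-≤ (≤-trans y-bound (+-monoʳ-≤ d (double-length≤head e dec)))
                             (sum-negative≤ z≤n (All.tail e) (Linked.tail dec) (Linked.tail gaps) tail-bound) ⟩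
  d + x + sum π  ≡⟨ +-assoc d x (sum π) ⟩
  d + (x + sum π) ∎
  where
  open ≤-Reasoning
  tail-bound : All (_≤ double (length π)) ν
  tail-bound = All.map (λ y>z → +-cancelˡ-≤ 4 _ _ (≤-trans y>z (≤-trans y-bound (+-monoˡ-≤ _ d≤2))))
                       (Linked⇒All-tail >[]-trans gaps)

positive-parts-bounded : ∀ {n π ν} → All PositiveEven π → Linked _>_ π → Linked (_>[ 4 ]_) ν →
                         All (_≤ double (length π)) ν → sum π ≡ n + sum ν → Bounded (2 + n) π
positive-parts-bounded {π = []} _ _ _ _ _ = []
positive-parts-bounded {n} {x ∷ π} {ν} e dec gaps ν-bounded signed-sum =
  Linked⇒All >[]-trans (≤2+⇒Bounded x≤2+n) (PositiveEven-separated e dec)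
  where
  open ≤-Reasoning
  x≤2+n : x ≤ 2 + n
  x≤2+n = subst (x ≤_) (+-comm n 2) (+-cancelʳ-≤ (sum π) x (n + 2) (begin
    x + sum π        ≡⟨ signed-sum ⟩
    n + sum ν        ≤⟨ +-monoʳ-≤ n (sum-negative≤ ≤-refl (All.tail e) (Linked.tail dec) gaps ν-bounded) ⟩
    n + (2 + sum π)  ≡⟨ +-assoc n 2 (sum π) ⟨
    n + 2 + sum π    ∎))

PositiveEven⇒%2≡0 : ∀ {x} → PositiveEven x → x % 2 ≡ 0
PositiveEven⇒%2≡0 (zero , refl) = refl
PositiveEven⇒%2≡0 (suc i , refl) = PositiveEven⇒%2≡0 (i , refl)

%2≡0⇒PositiveEven : ∀ {x} → 1 ≤ x → x % 2 ≡ 0 → PositiveEven x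
%2≡0⇒PositiveEven {suc zero} _ ()
%2≡0⇒PositiveEven {suc (suc zero)} _ _ = 0 , refl
%2≡0⇒PositiveEven {suc (suc (suc x))} _ x%2≡0 with %2≡0⇒PositiveEven {suc x} (s≤s z≤n) x%2≡0
... | i , refl = suc i , refl

OneMod4⇒%4≡1 : ∀ {y} → OneMod4 y → y % 4 ≡ 1
OneMod4⇒%4≡1 (zero , refl) = refl
OneMod4⇒%4≡1 (suc j , refl) = OneMod4⇒%4≡1 (j , refl)

%4≡1⇒OneMod4 : ∀ {y} → y % 4 ≡ 1 → OneMod4 y
%4≡1⇒OneMod4 {suc zero} _ = 0 , refl
%4≡1⇒OneMod4 {suc (suc (suc (suc y)))} y%4≡1 with %4≡1⇒OneMod4 {y} y%4≡1
... | j , refl = suc j , refl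

signed-valid : ∀ {n π ν} → IsLG'Signed n π ν → SignedPartitionBelow (2 + n) π ν
signed-valid s = record
  { positives = record
    { even = even
    ; decreasing = πDistinct
    ; bounded = positive-parts-bounded even πDistinct (Linked-strengthen OneMod4-> oneMod4 νDistinct)
                                       ν-bounded signedSum
    }
  ; oneMod4 = oneMod4
  ; ν-decreasing = νDistinct
  ; ν-bounded = ν-bounded
  }
  where
  open IsLG'Signed s
  even = All.zipWith (uncurry %2≡0⇒PositiveEven) (IsPartition.positive πPart , πEven)
  oneMod4 = All.map %4≡1⇒OneMod4 νMod4
  ν-bounded = All.map (subst (_ ≤_) (sym (double≡2* _))) νBound

signed-sound : ∀ {k n π ν} → SignedPartitionBelow k π ν → HasSignedWeight n (π , ν) → IsLG'Signed n π ν
signed-sound s weight = record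
  { πPart = record
    { positive = All.map (λ { (_ , refl) → s≤s z≤n }) even ; nonincr = Linked.map <⇒≤ decreasing ; sumIs = refl }
  ; νPart = record
    { positive = All.map (λ { (_ , refl) → s≤s z≤n }) oneMod4 ; nonincr = Linked.map <⇒≤ ν-decreasing ; sumIs = refl }
  ; signedSum = weight
  ; πDistinct = decreasing
  ; πEven = All.map PositiveEven⇒%2≡0 even
  ; νDistinct = ν-decreasing
  ; νMod4 = All.map OneMod4⇒%4≡1 oneMod4
  ; νBound = All.map (subst (_ ≤_) (double≡2* _)) ν-bounded
  }
  where
  open SignedPartitionBelow s
  open EvenPartsBelow positives

IsLG'Signed-irrelevant : ∀ {n π ν} (s t : IsLG'Signed n π ν) → s ≡ t
IsLG'Signed-irrelevant
  record { πPart = a ; νPart = b ; signedSum = c ; πDistinct = d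
         ; πEven = e ; νDistinct = f ; νMod4 = g ; νBound = h }
  record { πPart = a′ ; νPart = b′ ; signedSum = c′ ; πDistinct = d′
         ; πEven = e′ ; νDistinct = f′ ; νMod4 = g′ ; νBound = h′ }
  rewrite IsPartition-irrelevant a a′ | IsPartition-irrelevant b b′ | ≡-irrelevant c c′
        | Linked.irrelevant <-irrelevant d d′ | All.irrelevant ≡-irrelevant e e′
        | Linked.irrelevant <-irrelevant f f′ | All.irrelevant ≡-irrelevant g g′
        | All.irrelevant ≤-irrelevant h h′ = refl

LG'₋₁-enumeration : ∀ n → Fin (length (signedOfWeight n)) ↔ LG'₋₁ n
LG'₋₁-enumeration n =
  Fin-length↔Σ (≡-dec _≟_ ×-≟ ≡-dec _≟_) (signedOfWeight n)
    (Unique.filter⁺ (hasSignedWeight? n) (SignedListing.listing-unique signed-splitting (2 + n)))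
    (λ {p} → IsLG'Signed-irrelevant) complete sound
  where
  complete : ∀ {p} → uncurry (IsLG'Signed n) p → p ∈ signedOfWeight n
  complete s =
    ∈-filter⁺ (hasSignedWeight? n) (SignedListing.listing-complete signed-splitting (2 + n) (signed-valid s))
      (IsLG'Signed.signedSum s)
  sound : ∀ {p} → p ∈ signedOfWeight n → uncurry (IsLG'Signed n) p
  sound p∈ with ∈-filter⁻ (hasSignedWeight? n) p∈
  ... | p∈′ , weight = signed-sound (SignedListing.listing-sound signed-splitting (2 + n) p∈′) weight

theorem5p4 : (n : ℕ) → ∃[ k ] ((Fin k ↔ LG1 n) × (Fin k ↔ LG'₋₁ n))
theorem5p4 n =
  length (gapsOfWeight n) ,
  LG1-enumeration n ,
  subst (λ k → Fin k ↔ LG'₋₁ n) (sym (length-gapsOfWeight≡length-signedOfWeight n)) (LG'₋₁-enumeration n)
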